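{- Let $n\geq 2$ and $\boldsymbol{u}=(u_0,\dots,u_{n-1})\in U(n)$. Then (1) $\sum_{i=0}^{n-1}u_i=0$, and (2) the set of values $\{u_i : u_i>0\}$ has exactly one element and the set of values $\{u_i: u_i<0\}$ has exactly one element.
   Context: Definition of $\boldsymbol{w}(k)$ for integers $k\geq 2$: $\boldsymbol{w}(k)=(w(k)_0,\dots,w(k)_{k-1})$, where: if $k$ is odd, $w(k)_i=(k-1)/2$ for $i$ even and $w(k)_i=-(k+1)/2$ for $i$ odd; $\boldsymbol{w}(2)=(1,-1)$; $\boldsymbol{w}(4)=(1,-1,-1,1)$; if $k=2m$ is even with $k>4$, $w(k)_i=w(m)_{i \bmod m}$ for $0\le i\le k-1$. Definition of $U(n)$ for $n\ge 2$: build a rooted, vector-labeled binary tree $T_n$. The root is labeled $\boldsymbol{w}(n)\in\mathbb{R}^n$ (coordinates indexed $0,\dots,n-1$). For a vertex with label $\boldsymbol{u}$, let $i_0<\dots<i_{a'-1}$ be the indices $i$ with $u_i>0$ and $j_0<\dots<j_{a''-1}$ those with $u_j<0$. If $a'\ge2$, the vertex gets a left child labeled $\boldsymbol{u}'$ with $u'_{i_r}=w(a')_r$ ($0\le r\le a'-1$) and $u'_i=0$ otherwise. If $a''\ge 2$, it gets a right child labeled $\boldsymbol{u}''$ with $u''_{j_r}=w(a'')_r$ and $0$ otherwise. If $a'=a''=1$ the vertex is a leaf. $U(n)=\{\boldsymbol{u}^1,\dots,\boldsymbol{u}^{n-1}\}$ is the set of labels of the vertices of $T_n$, with $\boldsymbol{u}^i$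 the label of the $i$-th vertex visited in a depth-first (preorder) traversal, left child before right child. -}

module Defs where

open import Data.Nat as ℕ using (ℕ; zero; suc; _≤_)
open import Data.Nat.Base using (_/_; _%_)
open import Data.Integer as ℤ using (ℤ; +_; -_; _<?_)
open import Data.List using (List; []; _∷_; _++_; length; filter; foldr; applyUpTo)
open import Data.Bool using (Bool; true; false; if_then_else_)
open import Relation.Nullary.Decidable using (⌊_⌋)

-- Fuel-based recursion: wF f k with f ≥ k is exact, since the even case
-- k = 2m > 4 recurses on m < k.  w k := wF k k.  Values for k < 2 are junk
-- (never used: children are only formed when a' ≥ 2 or a'' ≥ 2).
wOdd : ℕ → List ℤ
wOdd k = applyUpTo (λ i → if ⌊ i % 2 ℕ.≟ 0 ⌋
                            then + ((k ℕ.∸ 1) / 2)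
                            else - (+ ((k ℕ.+ 1) / 2))) k

wF : ℕ → ℕ → List ℤ
wF zero    k = []
wF (suc f) 2 = + 1 ∷ - (+ 1) ∷ []
wF (suc f) 4 = + 1 ∷ - (+ 1) ∷ - (+ 1) ∷ + 1 ∷ []
wF (suc f) k = if ⌊ k % 2 ℕ.≟ 1 ⌋
                 then wOdd k
                 else (wF f (k / 2) ++ wF f (k / 2))

w : ℕ → List ℤ
w k = wF k k

place : (ℤ → Bool) → List ℤ → List ℤ → List ℤ
place p ws []       = []
place p []       (x ∷ u) = + 0 ∷ place p [] u
place p (y ∷ ws) (x ∷ u) = if p x then y ∷ place p ws u else + 0 ∷ place p (y ∷ ws) u

isPos : ℤ → Bool
isPos x = ⌊ + 0 <? x ⌋

isNeg : ℤ → Bool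
isNeg x = ⌊ x <? + 0 ⌋

numPos : List ℤ → ℕ
numPos u = length (filter (λ x → + 0 <? x) u)

numNeg : List ℤ → ℕ
numNeg u = length (filter (λ x → x <? + 0) u)

leftChild : List ℤ → List ℤ
leftChild u = place isPos (w (numPos u)) u

rightChild : List ℤ → List ℤ
rightChild u = place isNeg (w (numNeg u)) u

-- InU n u : u is the label of some vertex of the tree T_n, i.e. u ∈ U(n).
data InU (n : ℕ) : List ℤ → Set where
  root  : InU n (w n)
  left  : ∀ {u} → InU n u → 2 ≤ numPos u → InU n (leftChild u)
  right : ∀ {u} → InU n u → 2 ≤ numNeg u → InU n (rightChild u)

sumℤ : List ℤ → ℤ
sumℤ = foldr ℤ._+_ (+ 0)

-- A label of T_n is either w(n) or is obtained from some w(k), k ≥ 2, by writing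
-- its entries in order into the k coordinates of the parent carrying one sign, and
-- 0 elsewhere.  This keeps the sum and the set of nonzero values, so it suffices
-- that every w(k) sums to 0 and takes exactly one positive and one negative value.
-- For odd k = 2j+1 the entries alternate j and -(j+1), and (j+1)j - j(j+1) = 0;
-- for even k = 2m > 4, w(k) is w(m) written twice, which keeps both properties;
-- w(2) and w(4) are checked directly.
module Submission where

open import Defs
open import Data.Nat using (ℕ; _≤_)
open import Data.Integer using (ℤ; +_; _<_)
open import Data.List using (List)
open import Data.List.Membership.Propositional using (_∈_)
open import Data.Product using (_×_; ∃-syntax)
open import Relation.Binary.PropositionalEquality using (_≡_)
open import Function.Bundles using (_⇔_)

open import Data.Bool using (true; false; if_then_else_)
open import Data.Nat
  using (zero; suc; _*_; _/_; _%_; z≤n; s≤s; s≤s⁻¹; >-nonZero)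
  renaming (_+_ to _+ℕ_; _<_ to _<ℕ_; _≟_ to _≟ℕ_)
open import Data.Nat.Properties
  using (≤-refl; ≤-reflexive; ≤-trans; <-≤-trans; ≤∧≢⇒<; n<1⇒n≡0; m≤m*n; m<m*n;
         *-cancelʳ-≤; *-cancelʳ-<; +-comm; *-comm; +-identityʳ)
open import Data.Nat.DivMod using (m≡m%n+[m/n]*n; m%n<n; m*n/n≡m)
open import Data.Integer using (-[1+_]; +<+; -<+; _<?_)
  renaming (_+_ to _+ℤ_; _*_ to _*ℤ_; -_ to -ℤ_)
open import Data.Integer.Properties using (<⇒≢; <-asym; +-identityˡ)
open import Data.Integer.Tactic.RingSolver using (solve-∀)
open import Data.List using ([]; _∷_; _++_; length; filter; foldr; applyUpTo)
open import Data.List.Properties using (length-++; length-applyUpTo; foldr-++)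
open import Data.List.Relation.Unary.Any using (here; there)
open import Data.List.Membership.Propositional.Properties
  using (∈-applyUpTo⁺; ∈-applyUpTo⁻; ∈-++⁺ˡ; ∈-++⁻)
open import Data.Product using (_,_; map₁)
open import Data.Sum using (_⊎_; inj₁; inj₂; [_,_]′; reduce; swap; map₂)
open import Function using (id; _∘_)
open import Function.Bundles using (mk⇔; Equivalence)
open import Relation.Nullary using (¬_; contradiction)
open import Relation.Nullary.Decidable using (⌊_⌋; yes; no)
open import Relation.Unary using (Decidable)
open import Relation.Binary.PropositionalEquality
  using (refl; sym; trans; cong; cong₂; subst; _≢_; ≢-sym; module ≡-Reasoning)

HasUniqueValue : (ℤ → Set) → List ℤ → Set
HasUniqueValue P u = ∃[ p ] (∀ x → ((x ∈ u × P x) ⇔ x ≡ p))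

Balanced : List ℤ → Set
Balanced u = (sumℤ u ≡ + 0) × HasUniqueValue (+ 0 <_) u × HasUniqueValue (_< + 0) u

hasUniqueValue-two-valued : ∀ {P : ℤ → Set} {a b u} → P a → ¬ P b → a ∈ u →
  (∀ {x} → x ∈ u → x ≡ a ⊎ x ≡ b) → HasUniqueValue P u
hasUniqueValue-two-valued {P} {a} {u = u} Pa ¬Pb a∈u two-valued =
  a , λ x → mk⇔ only-a λ { refl → a∈u , Pa }
  where
  only-a : ∀ {x} → x ∈ u × P x → x ≡ a
  only-a (x∈u , Px) with two-valued x∈u
  ... | inj₁ x≡a  = x≡a
  ... | inj₂ refl = contradiction Px ¬Pb

hasUniqueValue-transfer : ∀ {P : ℤ → Set} {u v} → (∀ {x} → P x → x ≢ + 0) →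
  (∀ {x} → x ∈ u → x ∈ v) → (∀ {x} → x ∈ v → x ≡ + 0 ⊎ x ∈ u) →
  HasUniqueValue P u → HasUniqueValue P v
hasUniqueValue-transfer {P} {u} {v} P⇒≢0 u⊆v v⊆u∪0 (p , unique) =
  p , λ x → mk⇔ (λ (x∈v , Px) → Equivalence.to (unique x) (∈u x∈v Px , Px))
                (map₁ u⊆v ∘ Equivalence.from (unique x))
  where
  ∈u : ∀ {x} → x ∈ v → P x → x ∈ u
  ∈u x∈v Px = [ (λ x≡0 → contradiction x≡0 (P⇒≢0 Px)) , id ]′ (v⊆u∪0 x∈v)

balanced-two-valued : ∀ {a b u} → + 0 < a → b < + 0 → a ∈ u → b ∈ u →
  (∀ {x} → x ∈ u → x ≡ a ⊎ x ≡ b) → sumℤ u ≡ + 0 → Balanced u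
balanced-two-valued 0<a b<0 a∈u b∈u two-valued sum≡0 =
    sum≡0
  , hasUniqueValue-two-valued 0<a (<-asym b<0) a∈u two-valued
  , hasUniqueValue-two-valued b<0 (<-asym 0<a) b∈u (swap ∘ two-valued)

balanced-transfer : ∀ {u v} → (∀ {x} → x ∈ u → x ∈ v) →
  (∀ {x} → x ∈ v → x ≡ + 0 ⊎ x ∈ u) → sumℤ v ≡ + 0 → Balanced u → Balanced v
balanced-transfer u⊆v v⊆u∪0 sum≡0 (_ , positive , negative) =
    sum≡0
  , hasUniqueValue-transfer (λ 0<x → ≢-sym (<⇒≢ 0<x)) u⊆v v⊆u∪0 positive
  , hasUniqueValue-transfer <⇒≢ u⊆v v⊆u∪0 negative

balanced-double : ∀ ws → Balanced ws → Balanced (ws ++ ws)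
balanced-double ws balanced@(sum≡0 , _) =
  balanced-transfer ∈-++⁺ˡ (inj₂ ∘ reduce ∘ ∈-++⁻ ws) sum-double balanced
  where
  open ≡-Reasoning
  sum-double : sumℤ (ws ++ ws) ≡ + 0
  sum-double = begin
    sumℤ (ws ++ ws)          ≡⟨ foldr-++ _+ℤ_ (+ 0) ws ws ⟩
    foldr _+ℤ_ (sumℤ ws) ws  ≡⟨ cong (λ s → foldr _+ℤ_ s ws) sum≡0 ⟩
    sumℤ ws                  ≡⟨ sum≡0 ⟩
    + 0                      ∎

alternating : ℤ → ℤ → ℕ → ℤ
alternating a b i = if ⌊ i % 2 ≟ℕ 0 ⌋ then a else b

alternating-two-valued : ∀ a b i → alternating a b i ≡ a ⊎ alternating a b i ≡ b
alternating-two-valued a b i with ⌊ i % 2 ≟ℕ 0 ⌋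
... | true  = inj₁ refl
... | false = inj₂ refl

-- Shifting by two leaves alternating a b unchanged definitionally, since
-- suc (suc i) % 2 reduces to i % 2; likewise + 1 +ℤ + n reduces to + suc n.
sum-alternating : ∀ a b n →
  sumℤ (applyUpTo (alternating a b) (suc (n * 2))) ≡ + suc n *ℤ a +ℤ + n *ℤ b
sum-alternating a b zero = one-term a b
  where
  one-term : ∀ a b → a +ℤ + 0 ≡ + 1 *ℤ a +ℤ + 0 *ℤ b
  one-term = solve-∀
sum-alternating a b (suc n) = begin
  a +ℤ (b +ℤ sumℤ (applyUpTo (alternating a b) (suc (n * 2))))
    ≡⟨ cong (λ s → a +ℤ (b +ℤ s)) (sum-alternating a b n) ⟩
  a +ℤ (b +ℤ (+ suc n *ℤ a +ℤ + n *ℤ b))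
    ≡⟨ two-more-terms a b (+ n) ⟩
  + suc (suc n) *ℤ a +ℤ + suc n *ℤ b
    ∎
  where
  open ≡-Reasoning
  two-more-terms : ∀ a b m → a +ℤ (b +ℤ ((+ 1 +ℤ m) *ℤ a +ℤ m *ℤ b))
                              ≡ (+ 1 +ℤ (+ 1 +ℤ m)) *ℤ a +ℤ (+ 1 +ℤ m) *ℤ b
  two-more-terms = solve-∀

balanced-alternating : ∀ j → 1 ≤ j →
  Balanced (applyUpTo (alternating (+ j) -[1+ j ]) (suc (j * 2)))
balanced-alternating j 1≤j =
  balanced-two-valued (+<+ 1≤j) -<+
    (∈-applyUpTo⁺ alt (s≤s z≤n)) (∈-applyUpTo⁺ alt (s≤s (≤-trans 1≤j (m≤m*n j 2))))
    two-valued
    (trans (sum-alternating (+ j) -[1+ j ] j) (cancel (+ j)))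
  where
  alt : ℕ → ℤ
  alt = alternating (+ j) -[1+ j ]
  two-valued : ∀ {x} → x ∈ applyUpTo alt (suc (j * 2)) → x ≡ + j ⊎ x ≡ -[1+ j ]
  two-valued x∈ with i , _ , refl ← ∈-applyUpTo⁻ alt x∈ = alternating-two-valued _ _ i
  cancel : ∀ m → (+ 1 +ℤ m) *ℤ m +ℤ m *ℤ (-ℤ (+ 1 +ℤ m)) ≡ + 0
  cancel = solve-∀

wOdd-odd : ∀ j → wOdd (suc (j * 2)) ≡ applyUpTo (alternating (+ j) -[1+ j ]) (suc (j * 2))
wOdd-odd j = cong₂ (λ a b → applyUpTo (alternating (+ a) (-ℤ (+ b))) (suc (j * 2)))
  (m*n/n≡m j 2)
  (trans (cong (_/ 2) (+-comm (suc (j * 2)) 1)) (m*n/n≡m (suc j) 2))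

m%2≡1⇒m≡1+[m/2]*2 : ∀ m → m % 2 ≡ 1 → m ≡ suc (m / 2 * 2)
m%2≡1⇒m≡1+[m/2]*2 m m%2≡1 = trans (m≡m%n+[m/n]*n m 2) (cong (_+ℕ m / 2 * 2) m%2≡1)

m%2≢1⇒m≡[m/2]*2 : ∀ m → m % 2 ≢ 1 → m ≡ m / 2 * 2
m%2≢1⇒m≡[m/2]*2 m m%2≢1 = trans (m≡m%n+[m/n]*n m 2) (cong (_+ℕ m / 2 * 2) m%2≡0)
  where
  m%2≡0 : m % 2 ≡ 0
  m%2≡0 = n<1⇒n≡0 (≤∧≢⇒< (s≤s⁻¹ (m%n<n m 2)) m%2≢1)

w-induction : (P : ℕ → List ℤ → Set) →
  P 2 (+ 1 ∷ -[1+ 0 ] ∷ []) →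
  P 4 (+ 1 ∷ -[1+ 0 ] ∷ -[1+ 0 ] ∷ + 1 ∷ []) →
  (∀ j → 1 ≤ j → P (suc (j * 2)) (applyUpTo (alternating (+ j) -[1+ j ]) (suc (j * 2)))) →
  (∀ m ws → P m ws → P (m * 2) (ws ++ ws)) →
  ∀ {k} → 2 ≤ k → P k (w k)
w-induction P P-w2 P-w4 P-odd P-double {k} 2≤k = wF-induction k k 2≤k ≤-refl
  where
  odd-case : ∀ j → 3 ≤ suc (j * 2) → P (suc (j * 2)) (wOdd (suc (j * 2)))
  odd-case j 3≤1+j*2 =
    subst (P _) (sym (wOdd-odd j)) (P-odd j (*-cancelʳ-≤ 1 j 2 (s≤s⁻¹ 3≤1+j*2)))

  mutual
    wF-induction : ∀ f k → 2 ≤ k → k ≤ f → P k (wF f k)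
    wF-induction zero    (suc (suc _)) _ ()
    wF-induction (suc f) 1 (s≤s ()) _
    wF-induction (suc f) 2 _ _ = P-w2
    wF-induction (suc f) 3 _ k≤1+f = fuelled-step f 3 ≤-refl k≤1+f
    wF-induction (suc f) 4 _ _ = P-w4
    wF-induction (suc f) k@(suc (suc (suc (suc (suc _))))) _ k≤1+f =
      fuelled-step f k (s≤s (s≤s (s≤s z≤n))) k≤1+f

    fuelled-step : ∀ f k → 3 ≤ k → k ≤ suc f →
      P k (if ⌊ k % 2 ≟ℕ 1 ⌋ then wOdd k else (wF f (k / 2) ++ wF f (k / 2)))
    fuelled-step f k 3≤k k≤1+f with k % 2 ≟ℕ 1
    ... | yes k%2≡1 =
      subst (λ k → P k (wOdd k)) (sym k≡)
        (odd-case (k / 2) (subst (3 ≤_) k≡ 3≤k))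
      where
      k≡ : k ≡ suc (k / 2 * 2)
      k≡ = m%2≡1⇒m≡1+[m/2]*2 k k%2≡1
    ... | no k%2≢1 =
      subst (λ n → P n (wF f (k / 2) ++ wF f (k / 2))) (sym k≡)
        (even-case f (k / 2) (subst (3 ≤_) k≡ 3≤k) (subst (_≤ suc f) k≡ k≤1+f))
      where
      k≡ : k ≡ k / 2 * 2
      k≡ = m%2≢1⇒m≡[m/2]*2 k k%2≢1

    even-case : ∀ f j → 3 ≤ j * 2 → j * 2 ≤ suc f → P (j * 2) (wF f j ++ wF f j)
    even-case f j 3≤j*2 j*2≤1+f =
      P-double j (wF f j) (wF-induction f j 2≤j (s≤s⁻¹ (<-≤-trans j<j*2 j*2≤1+f)))
      where
      2≤j : 2 ≤ j
      2≤j = *-cancelʳ-< 2 1 j 3≤j*2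
      j<j*2 : j <ℕ j * 2
      j<j*2 = m<m*n j 2 {{>-nonZero (≤-trans (s≤s z≤n) 2≤j)}} ≤-refl

w-balanced : ∀ {k} → 2 ≤ k → Balanced (w k)
w-balanced = w-induction (λ _ → Balanced)
  (balanced-two-valued (+<+ ≤-refl) -<+ (here refl) (there (here refl))
    (λ { (here refl) → inj₁ refl ; (there (here refl)) → inj₂ refl
       ; (there (there ())) })
    refl)
  (balanced-two-valued (+<+ ≤-refl) -<+ (here refl) (there (here refl))
    (λ { (here refl) → inj₁ refl ; (there (here refl)) → inj₂ refl
       ; (there (there (here refl))) → inj₂ refl
       ; (there (there (there (here refl)))) → inj₁ refl
       ; (there (there (there (there ())))) })
    refl)
  balanced-alternating
  (λ _ → balanced-double)

length-w : ∀ {k} → 2 ≤ k → length (w k) ≡ k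
length-w = w-induction (λ k ws → length ws ≡ k) refl refl
  (λ j _ → length-applyUpTo (alternating (+ j) -[1+ j ]) (suc (j * 2)))
  length-double
  where
  open ≡-Reasoning
  length-double : ∀ m ws → length ws ≡ m → length (ws ++ ws) ≡ m * 2
  length-double _ ws refl = begin
    length (ws ++ ws)       ≡⟨ length-++ ws ⟩
    length ws +ℕ length ws  ≡⟨ cong (length ws +ℕ_) (sym (+-identityʳ (length ws))) ⟩
    2 * length ws           ≡⟨ *-comm 2 (length ws) ⟩
    length ws * 2           ∎

sumℤ-place-[] : ∀ p u → sumℤ (place p [] u) ≡ + 0
sumℤ-place-[] p []      = refl
sumℤ-place-[] p (_ ∷ u) = trans (+-identityˡ (sumℤ (place p [] u))) (sumℤ-place-[] p u)

∈-place⁻ : ∀ p ws u {x} → x ∈ place p ws u → x ≡ + 0 ⊎ x ∈ ws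
∈-place⁻ p []       (_ ∷ u) (here x≡0) = inj₁ x≡0
∈-place⁻ p []       (_ ∷ u) (there x∈) = ∈-place⁻ p [] u x∈
∈-place⁻ p (v ∷ ws) (y ∷ u) x∈ with p y
∈-place⁻ p (v ∷ ws) (y ∷ u) (here x≡v) | true  = inj₂ (here x≡v)
∈-place⁻ p (v ∷ ws) (y ∷ u) (there x∈) | true  = map₂ there (∈-place⁻ p ws u x∈)
∈-place⁻ p (v ∷ ws) (y ∷ u) (here x≡0) | false = inj₁ x≡0
∈-place⁻ p (v ∷ ws) (y ∷ u) (there x∈) | false = ∈-place⁻ p (v ∷ ws) u x∈

module _ {P : ℤ → Set} (P? : Decidable P) where

  ∈-place⁺ : ∀ ws u {x} → length ws ≤ length (filter P? u) →
    x ∈ ws → x ∈ place (⌊_⌋ ∘ P?) ws u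
  ∈-place⁺ (v ∷ ws) (y ∷ u) fits x∈ with P? y
  ∈-place⁺ (v ∷ ws) (y ∷ u) _          (here x≡v) | yes _ = here x≡v
  ∈-place⁺ (v ∷ ws) (y ∷ u) (s≤s fits) (there x∈) | yes _ = there (∈-place⁺ ws u fits x∈)
  ∈-place⁺ (v ∷ ws) (y ∷ u) fits       x∈         | no _  = there (∈-place⁺ (v ∷ ws) u fits x∈)

  sumℤ-place : ∀ ws u → length ws ≤ length (filter P? u) →
    sumℤ (place (⌊_⌋ ∘ P?) ws u) ≡ sumℤ ws
  sumℤ-place []       u       _ = sumℤ-place-[] (⌊_⌋ ∘ P?) u
  sumℤ-place (v ∷ ws) (y ∷ u) fits with P? y
  sumℤ-place (v ∷ ws) (y ∷ u) (s≤s fits) | yes _ = cong (v +ℤ_) (sumℤ-place ws u fits)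
  sumℤ-place (v ∷ ws) (y ∷ u) fits       | no _  =
    trans (+-identityˡ _) (sumℤ-place (v ∷ ws) u fits)

  balanced-place : ∀ ws u → length ws ≤ length (filter P? u) →
    Balanced ws → Balanced (place (⌊_⌋ ∘ P?) ws u)
  balanced-place ws u fits balanced@(sum≡0 , _) =
    balanced-transfer (∈-place⁺ ws u fits) (∈-place⁻ (⌊_⌋ ∘ P?) ws u)
      (trans (sumℤ-place ws u fits) sum≡0) balanced

  balanced-place-w : ∀ u → 2 ≤ length (filter P? u) →
    Balanced (place (⌊_⌋ ∘ P?) (w (length (filter P? u))) u)
  balanced-place-w u 2≤a =
    balanced-place (w (length (filter P? u))) u
      (≤-reflexive (length-w 2≤a)) (w-balanced 2≤a)

lemma3p3 : (n : ℕ) → 2 ≤ n → (u : List ℤ) → InU n u →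
    (sumℤ u ≡ + 0)
    × (∃[ p ] (∀ x → ((x ∈ u × + 0 < x) ⇔ x ≡ p)))
    × (∃[ q ] (∀ x → ((x ∈ u × x < + 0) ⇔ x ≡ q)))
lemma3p3 n 2≤n .(w n) root = w-balanced 2≤n
-- A child's label depends only on the sign pattern of its parent, so no induction
-- along the tree is needed.
lemma3p3 _ _ .(leftChild u)  (left  {u} _ 2≤a′) = balanced-place-w (+ 0 <?_) u 2≤a′
lemma3p3 _ _ .(rightChild u) (right {u} _ 2≤a″) = balanced-place-w (_<? + 0) u 2≤a″
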